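{- Let $L\subseteq R$ and let $\mathcal{A}$ be an axiom system with $\mathcal{A}\supseteq\mathcal{A}_L$. Then $D^{\mathcal{A}}_{\mathrm{surpr}}\neq\emptyset$ if and only if $\tau^{\mathcal{A}}\equiv\top$.
   Context: Let $R=\{\mathrm{Mo},\mathrm{Tu},\mathrm{We},\mathrm{Th},\mathrm{Fr},\mathrm{none}\}$ be linearly ordered by $\mathrm{Mo}<\mathrm{Tu}<\mathrm{We}<\mathrm{Th}<\mathrm{Fr}<\mathrm{none}$, and $D=\{\mathrm{Mo},\dots,\mathrm{Fr}\}$. Propositional formulas are built from atoms $Y_r$ ($r\in R$) with $\bot,\to$ (usual derived connectives, $\top:=\neg\bot$). The axiom $(\mathrm{Ax}_{=1})$ is $\bigvee_{r\in R}Y_r\wedge\bigwedge_{r<s}(\neg Y_r\vee\neg Y_s)$; its models are identified with the elements of $R$ ($r$ makes exactly $Y_r$ true). $\varphi\equiv\psi$ means $\varphi,\psi$ have the same truth value in every $r\in R$. An axiom system $\mathcal{A}$ is a set of formulas always containing $(\mathrm{Ax}_{=1})$; $\mathcal{A}\vdash\varphi$ is propositional provability. For $B\subseteq R$: $\langle T\in B\rangle:=\bigvee_{r\in B}Y_r$, $\langle T\le d\rangle:=\langle T\in\{r:r\le d\}\rangle$. $\mathcal{A}_L$ denotes the axiom system $\{(\mathrm{Ax}_{=1}),\langle T\in L\rangle\}$. $K\subseteq R$ is an $\mathcal{A}$-p-knowledge set if $\mathcal{A}\vdash\langle T\in K\rangle$; $K_{\mathcal{A}}$ is the intersection of all of them.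 $d\in D$ is $\mathcal{A}$-p-surprising if $d\in K_{\mathcal{A}}$ and $\mathcal{A}\nvdash\langle T\le d\rangle$; $D^{\mathcal{A}}_{\mathrm{surpr}}$ is the set of these. Iverson brackets: $[S]$ is $\top$ if the assertion $S$ is true, $\bot$ otherwise. Define $\tau^{\mathcal{A}}:=\bigvee_{d\in D}\bigwedge_{K\subseteq R}\bigl([\,\mathcal{A}\vdash\langle T\in K\rangle\,]\to[\,d\in K-\{\max K\}\,]\bigr)$, with the convention $\emptyset-\{\max\emptyset\}=\emptyset$ (so $\tau^{\mathcal{A}}$ is a variable-free formula, equivalent to $\top$ or to $\bot$). -}

module Defs where

open import Data.Nat using (ℕ; suc; _<ᵇ_; _≤ᵇ_)
open import Data.Fin using (Fin; zero; suc; toℕ; inject₁)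
open import Data.Fin.Subset using (Subset; _∈_; _─_; ⁅_⁆; ⊥)
open import Data.Bool using (Bool; true; false; if_then_else_)
open import Data.Vec using (Vec; []; _∷_; lookup)
open import Data.List using (List; []; _∷_; map; foldr; filterᵇ; concatMap)
open import Data.List.Base using (allFin)
open import Data.Maybe using (Maybe; just; nothing)
open import Data.Product using (Σ; _×_; _,_)
open import Data.Sum using (_⊎_)
open import Data.Empty renaming (⊥ to Empty)
open import Relation.Binary.PropositionalEquality using (_≡_)
open import Relation.Nullary using (¬_)
open import Function.Bundles using (_⇔_)

-- The set R = {Mo,Tu,We,Th,Fr,none}, encoded as Fin 6 with the order of
-- indices: Mo=0 < Tu=1 < We=2 < Th=3 < Fr=4 < none=5.
-- D = {Mo,...,Fr} is encoded as Fin 5, embedded into R by inject₁.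

R : Set
R = Fin 6

D : Set
D = Fin 5

ιD : D → R
ιD = inject₁

infixr 5 _⇒_

data Form : Set where
  Y   : R → Form
  ⊥ᶠ  : Form
  _⇒_ : Form → Form → Form

¬ᶠ_ : Form → Form
¬ᶠ φ = φ ⇒ ⊥ᶠ

⊤ᶠ : Form
⊤ᶠ = ¬ᶠ ⊥ᶠ

_∨ᶠ_ : Form → Form → Form
φ ∨ᶠ ψ = (¬ᶠ φ) ⇒ ψ

_∧ᶠ_ : Form → Form → Form
φ ∧ᶠ ψ = ¬ᶠ (φ ⇒ ¬ᶠ ψ)

⋁ᶠ : List Form → Form
⋁ᶠ = foldr _∨ᶠ_ ⊥ᶠ

⋀ᶠ : List Form → Form
⋀ᶠ = foldr _∧ᶠ_ ⊤ᶠ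

allR : List R
allR = allFin 6

pairsLt : List (R × R)
pairsLt = concatMap (λ r → map (λ s → (r , s))
                       (filterᵇ (λ s → toℕ r <ᵇ toℕ s) allR)) allR

Ax=1 : Form
Ax=1 = ⋁ᶠ (map Y allR) ∧ᶠ ⋀ᶠ (map (λ { (r , s) → (¬ᶠ Y r) ∨ᶠ (¬ᶠ Y s) }) pairsLt)

⟨T∈_⟩ : Subset 6 → Form
⟨T∈ B ⟩ = ⋁ᶠ (map Y (filterᵇ (λ r → lookup B r) allR))

≤set : R → Subset 6
≤set d = Data.Vec.tabulate (λ r → toℕ r ≤ᵇ toℕ d)
  where import Data.Vec

⟨T≤_⟩ : R → Form
⟨T≤ d ⟩ = ⟨T∈ ≤set d ⟩

AxSystem : Set₁
AxSystem = Form → Set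

infix 3 _⊢_

data _⊢_ (𝒜 : AxSystem) : Form → Set where
  hyp : ∀ {φ} → 𝒜 φ → 𝒜 ⊢ φ
  axK : ∀ {φ ψ} → 𝒜 ⊢ φ ⇒ ψ ⇒ φ
  axS : ∀ {φ ψ χ} → 𝒜 ⊢ (φ ⇒ ψ ⇒ χ) ⇒ (φ ⇒ ψ) ⇒ φ ⇒ χ
  axDN : ∀ {φ} → 𝒜 ⊢ (¬ᶠ ¬ᶠ φ) ⇒ φ
  mp : ∀ {φ ψ} → 𝒜 ⊢ φ ⇒ ψ → 𝒜 ⊢ φ → 𝒜 ⊢ ψ

IsAxSystem : AxSystem → Set
IsAxSystem 𝒜 = 𝒜 Ax=1

𝒜[_] : Subset 6 → AxSystem
𝒜[ L ] φ = (φ ≡ Ax=1) ⊎ (φ ≡ ⟨T∈ L ⟩)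

_⊇ᴬ_ : AxSystem → AxSystem → Set
𝒜 ⊇ᴬ ℬ = ∀ φ → ℬ φ → 𝒜 φ

IsKnowledgeSet : AxSystem → Subset 6 → Set
IsKnowledgeSet 𝒜 K = 𝒜 ⊢ ⟨T∈ K ⟩

_∈K[_] : R → AxSystem → Set
r ∈K[ 𝒜 ] = ∀ (K : Subset 6) → IsKnowledgeSet 𝒜 K → r ∈ K

Surprising : AxSystem → D → Set
Surprising 𝒜 d = (ιD d ∈K[ 𝒜 ]) × ¬ (𝒜 ⊢ ⟨T≤ ιD d ⟩)

SurprNonempty : AxSystem → Set
SurprNonempty 𝒜 = Σ D (Surprising 𝒜)

-- max K (in the order of R) and K - {max K}, with ∅ - {max ∅} = ∅

maxS : ∀ {n} → Subset n → Maybe (Fin n)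
maxS [] = nothing
maxS (b ∷ K) with maxS K
... | just m  = just (suc m)
... | nothing = if b then just zero else nothing

removeMax : ∀ {n} → Subset n → Subset n
removeMax K with maxS K
... | just m  = K ─ ⁅ m ⁆
... | nothing = ⊥

-- An Iverson bracket [S]
-- of an arbitrary (meta-level) assertion S is represented by the
-- assertion itself; truth values are read propositionally (as types):
-- [S] is true iff S holds.

data MForm : Set₁ where
  ⊥ᵐ   : MForm
  _⇒ᵐ_ : MForm → MForm → MForm
  [_]  : Set → MForm
  ⋁ᵐ   : (I : Set) → (I → MForm) → MForm
  ⋀ᵐ   : (I : Set) → (I → MForm) → MForm

⊤ᵐ : MForm
⊤ᵐ = ⊥ᵐ ⇒ᵐ ⊥ᵐ

-- truth value (variable-free, so independent of the model r ∈ R)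
⟦_⟧ : MForm → Set
⟦ ⊥ᵐ ⟧ = Empty
⟦ φ ⇒ᵐ ψ ⟧ = ⟦ φ ⟧ → ⟦ ψ ⟧
⟦ [ S ] ⟧ = S
⟦ ⋁ᵐ I f ⟧ = Σ I (λ i → ⟦ f i ⟧)
⟦ ⋀ᵐ I f ⟧ = ∀ i → ⟦ f i ⟧

_≡ᵐ_ : MForm → MForm → Set
φ ≡ᵐ ψ = R → (⟦ φ ⟧ ⇔ ⟦ ψ ⟧)

τ : AxSystem → MForm
τ 𝒜 = ⋁ᵐ D (λ d → ⋀ᵐ (Subset 6) (λ K →
        [ 𝒜 ⊢ ⟨T∈ K ⟩ ] ⇒ᵐ [ ιD d ∈ removeMax K ]))

{-# OPTIONS --safe #-}
module Submission where

-- A day d is surprising exactly when it lies in every provable knowledge set K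
-- without being its maximum.  Indeed, if d = max K then K ⊆ {r : r ≤ d}, so
-- ⟨T ≤ d⟩ would be provable; conversely, if ⟨T ≤ d⟩ is provable then {r : r ≤ d}
-- is itself a knowledge set, and d is its maximum.  Hence D_surpr ≠ ∅ says
-- precisely that the inner conjunction of τ holds for some d; since τ is
-- variable-free, that is the same as τ ≡ ⊤.

open import Defs
open import Data.Bool using (Bool; true; false)
open import Data.Fin using (zero; suc; toℕ)
open import Data.Fin.Subset using (Subset; _∈_; _∉_; _⊆_; _─_; ⁅_⁆)
open import Data.Fin.Subset.Properties
  using (p─q⊆p; x∈p∧x∉q⇒x∈p─q; x∈⁅x⁆; x∈⁅y⁆⇒x≡y; ∉⊥)
open import Data.List using (List; []; _∷_; map; filterᵇ)
open import Data.Maybe using (just; nothing)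
open import Data.Nat using (_≤_; z≤n; s≤s; _≤ᵇ_)
open import Data.Nat.Properties using (≤⇒≤ᵇ)
open import Data.Bool.Properties using (T-≡)
open import Data.Product using (_,_)
open import Data.Vec using (_∷_; here; there; lookup)
open import Data.Vec.Properties using ([]=⇒lookup; lookup⇒[]=; lookup∘tabulate)
open import Data.Product.Function.Dependent.Propositional using (Σ-⇔)
open import Function using (id)
open import Function.Bundles using (_⇔_; mk⇔; Equivalence)
open import Function.Construct.Composition using (_⇔-∘_)
open import Function.Construct.Identity using (↠-id)
open import Relation.Binary.PropositionalEquality using (_≡_; _≢_; refl; trans; sym; cong)
open import Relation.Nullary using (contradiction)

module _ {𝒜 : AxSystem} where

  ⇒-refl : ∀ {φ} → 𝒜 ⊢ φ ⇒ φ
  ⇒-refl {φ} = mp (mp axS axK) (axK {ψ = φ})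

  ⇒-monoʳ : ∀ {φ ψ χ} → 𝒜 ⊢ ψ ⇒ χ → 𝒜 ⊢ (φ ⇒ ψ) ⇒ (φ ⇒ χ)
  ⇒-monoʳ ψ⇒χ = mp axS (mp axK ψ⇒χ)

  ⇒-trans : ∀ {φ ψ χ} → 𝒜 ⊢ φ ⇒ ψ → 𝒜 ⊢ ψ ⇒ χ → 𝒜 ⊢ φ ⇒ χ
  ⇒-trans φ⇒ψ ψ⇒χ = mp (⇒-monoʳ ψ⇒χ) φ⇒ψ

  ⋁Y-filterᵇ-mono : (p q : R → Bool) → (∀ {r} → p r ≡ true → q r ≡ true) → (rs : List R) →
                    𝒜 ⊢ ⋁ᶠ (map Y (filterᵇ p rs)) ⇒ ⋁ᶠ (map Y (filterᵇ q rs))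
  ⋁Y-filterᵇ-mono p q p⇒q [] = ⇒-refl
  ⋁Y-filterᵇ-mono p q p⇒q (r ∷ rs) with p r in pr | q r in qr
  ... | true  | true  = ⇒-monoʳ (⋁Y-filterᵇ-mono p q p⇒q rs)
  ... | true  | false = contradiction (trans (sym (p⇒q pr)) qr) λ ()
  ... | false | true  = ⇒-trans (⋁Y-filterᵇ-mono p q p⇒q rs) axK
  ... | false | false = ⋁Y-filterᵇ-mono p q p⇒q rs

  ⟨T∈⟩-mono : ∀ {K K′} → K ⊆ K′ → 𝒜 ⊢ ⟨T∈ K ⟩ ⇒ ⟨T∈ K′ ⟩
  ⟨T∈⟩-mono {K} {K′} K⊆K′ = ⋁Y-filterᵇ-mono (lookup K) (lookup K′)
    (λ {r} r∈K → []=⇒lookup (K⊆K′ (lookup⇒[]= r K r∈K))) allR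

  knowledgeSet-⊆ : ∀ {K K′} → IsKnowledgeSet 𝒜 K → K ⊆ K′ → IsKnowledgeSet 𝒜 K′
  knowledgeSet-⊆ ⊢K K⊆K′ = mp (⟨T∈⟩-mono K⊆K′) ⊢K

maxS≡nothing⇒∉ : ∀ {n} (K : Subset n) {x} → maxS K ≡ nothing → x ∉ K
maxS≡nothing⇒∉ (_ ∷ K) eq x∈K        with maxS K in eqK
maxS≡nothing⇒∉ (_ ∷ K) () here        | nothing
maxS≡nothing⇒∉ (_ ∷ K) eq (there x∈K) | nothing = maxS≡nothing⇒∉ K eqK x∈K

maxS-upper : ∀ {n} (K : Subset n) {m x} → maxS K ≡ just m → x ∈ K → toℕ x ≤ toℕ m
maxS-upper (_ ∷ K) {x = zero}  eq x∈K = z≤n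
maxS-upper (_ ∷ K) {x = suc x} eq (there x∈K) with maxS K in eqK
... | just m  with refl ← eq = s≤s (maxS-upper K eqK x∈K)
... | nothing = contradiction x∈K (maxS≡nothing⇒∉ K eqK)

x∈p─q⇒x∉q : ∀ {n} (p q : Subset n) {x} → x ∈ p ─ q → x ∉ q
x∈p─q⇒x∉q (_ ∷ p) (_ ∷ q) (there x∈p─q) (there x∈q) = x∈p─q⇒x∉q p q x∈p─q x∈q

removeMax⊆ : ∀ {n} (K : Subset n) → removeMax K ⊆ K
removeMax⊆ K x∈ with maxS K
... | just m  = p─q⊆p K ⁅ m ⁆ x∈
... | nothing = contradiction x∈ ∉⊥

max∉removeMax : ∀ {n} (K : Subset n) {m} → maxS K ≡ just m → m ∉ removeMax K
max∉removeMax K eq m∈ with maxS K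
max∉removeMax K refl m∈ | just m = x∈p─q⇒x∉q K ⁅ m ⁆ m∈ (x∈⁅x⁆ m)

∈removeMax : ∀ {n} (K : Subset n) {x} → x ∈ K → maxS K ≢ just x → x ∈ removeMax K
∈removeMax K x∈K x≢max with maxS K in eq
... | just m  = x∈p∧x∉q⇒x∈p─q x∈K λ x∈⁅m⁆ → x≢max (cong just (sym (x∈⁅y⁆⇒x≡y m x∈⁅m⁆)))
... | nothing = contradiction x∈K (maxS≡nothing⇒∉ K eq)

∈≤set : ∀ {x m : R} → toℕ x ≤ toℕ m → x ∈ ≤set m
∈≤set {x} {m} x≤m =
  lookup⇒[]= x (≤set m)
    (trans (lookup∘tabulate (λ r → toℕ r ≤ᵇ toℕ m) x) (Equivalence.to T-≡ (≤⇒≤ᵇ x≤m)))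

maxS⇒⊆≤set : ∀ (K : Subset 6) {m} → maxS K ≡ just m → K ⊆ ≤set m
maxS⇒⊆≤set K eq x∈K = ∈≤set (maxS-upper K eq x∈K)

maxS-≤set : ∀ (r : R) → maxS (≤set r) ≡ just r
maxS-≤set zero                                = refl
maxS-≤set (suc zero)                          = refl
maxS-≤set (suc (suc zero))                    = refl
maxS-≤set (suc (suc (suc zero)))              = refl
maxS-≤set (suc (suc (suc (suc zero))))        = refl
maxS-≤set (suc (suc (suc (suc (suc zero)))))  = refl

surprising⇔∈removeMax : ∀ {𝒜} (d : D) →
  Surprising 𝒜 d ⇔ (∀ K → IsKnowledgeSet 𝒜 K → ιD d ∈ removeMax K)
surprising⇔∈removeMax {𝒜} d = mk⇔ to from
  where
  to : Surprising 𝒜 d → ∀ K → IsKnowledgeSet 𝒜 K → ιD d ∈ removeMax K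
  to (d∈K𝒜 , ⊬T≤d) K ⊢K = ∈removeMax K (d∈K𝒜 K ⊢K)
    λ d≡max → ⊬T≤d (knowledgeSet-⊆ ⊢K (maxS⇒⊆≤set K d≡max))

  from : (∀ K → IsKnowledgeSet 𝒜 K → ιD d ∈ removeMax K) → Surprising 𝒜 d
  from ∈removeMaxK = (λ K ⊢K → removeMax⊆ K (∈removeMaxK K ⊢K))
                   , λ ⊢T≤d → max∉removeMax (≤set (ιD d)) (maxS-≤set (ιD d))
                                (∈removeMaxK (≤set (ιD d)) ⊢T≤d)

⟦⟧⇔≡ᵐ⊤ᵐ : ∀ φ → ⟦ φ ⟧ ⇔ (φ ≡ᵐ ⊤ᵐ)
⟦⟧⇔≡ᵐ⊤ᵐ φ = mk⇔ (λ ⟦φ⟧ _ → mk⇔ (λ _ → id) (λ _ → ⟦φ⟧))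
                (λ φ≡⊤ → Equivalence.from (φ≡⊤ zero) id)

proposition5p3 : (L : Subset 6) (𝒜 : AxSystem) → IsAxSystem 𝒜 → 𝒜 ⊇ᴬ 𝒜[ L ] →
    SurprNonempty 𝒜 ⇔ (τ 𝒜 ≡ᵐ ⊤ᵐ)
proposition5p3 _ 𝒜 _ _ = ⟦⟧⇔≡ᵐ⊤ᵐ (τ 𝒜) ⇔-∘ Σ-⇔ (↠-id D) (surprising⇔∈removeMax _)
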